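{- If a graph $G$ contains no co-triangle, then $G$ is perfectly divisible.
   Context: All graphs are finite and simple. A co-triangle is a stable set of three vertices. $\chi$ is the chromatic number and $\omega$ the maximum clique size; a graph is perfect if $\chi(F)=\omega(F)$ for all its induced subgraphs $F$. A graph $G$ is perfectly divisible if every induced subgraph $H$ of $G$ contains a set $X$ of vertices such that $X$ meets every clique of $H$ of size $\omega(H)$ and $H[X]$ is perfect. -}

module Defs where

open import Data.Nat using (ℕ; _≤_; _<_)
open import Data.Fin using (Fin)
open import Data.Fin.Subset using (Subset; _∈_; _⊆_; ∣_∣)
open import Data.Bool using (Bool; true; false)
open import Data.Product using (Σ; _×_; ∃-syntax)
open import Relation.Binary.PropositionalEquality using (_≡_; _≢_)

record Graph : Set where
  field
    n     : ℕ
    adj   : Fin n → Fin n → Bool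
    sym   : ∀ u v → adj u v ≡ adj v u
    irrefl : ∀ v → adj v v ≡ false

module _ (G : Graph) where
  open Graph G

  HasCoTriangle : Set
  HasCoTriangle = Σ (Fin n) λ a → Σ (Fin n) λ b → Σ (Fin n) λ c →
    (a ≢ b) × (a ≢ c) × (b ≢ c) ×
    (adj a b ≡ false) × (adj a c ≡ false) × (adj b c ≡ false)

  -- Induced subgraphs are given by their vertex sets S : Subset n.
  -- C is a clique of G[S].
  IsClique : Subset n → Subset n → Set
  IsClique S C = (C ⊆ S) × (∀ u v → u ∈ C → v ∈ C → u ≢ v → adj u v ≡ true)

  IsMaxClique : Subset n → Subset n → Set
  IsMaxClique S C = IsClique S C × (∀ D → IsClique S D → ∣ D ∣ ≤ ∣ C ∣)

  CliqueNumber : Subset n → ℕ → Set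
  CliqueNumber S k = Σ (Subset n) λ C → IsMaxClique S C × (∣ C ∣ ≡ k)

  ProperColouring : Subset n → ℕ → Set
  ProperColouring S k = Σ ((v : Fin n) → v ∈ S → Fin k) λ c →
    ∀ u v (u∈ : u ∈ S) (v∈ : v ∈ S) → adj u v ≡ true → c u u∈ ≢ c v v∈

  ChromaticNumber : Subset n → ℕ → Set
  ChromaticNumber S k = ProperColouring S k × (∀ m → ProperColouring S m → k ≤ m)

  IsPerfect : Subset n → Set
  IsPerfect S = ∀ F → F ⊆ S → ∃[ k ] (ChromaticNumber F k × CliqueNumber F k)

  -- G is perfectly divisible. (For empty H, ω(H)=0 and the only maximum clique is
  -- empty; the meeting condition is imposed only on nonempty maximum cliques.)
  PerfectlyDivisible : Set
  PerfectlyDivisible = ∀ (H : Subset n) → ∃[ X ] ((X ⊆ H) ×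
    (∀ C → IsMaxClique H C → 0 < ∣ C ∣ → ∃[ v ] (v ∈ C × v ∈ X)) × IsPerfect X)

module Submission where

-- Let H be an induced subgraph.  If H is empty, X = H works trivially.
-- Otherwise pick a vertex v of H and let X be the set of non-neighbours
-- of v in H (v itself included).
--   * X meets every maximum clique C of H: if every vertex of C were
--     adjacent to v, then v ∉ C and C ∪ {v} would be a larger clique.
--   * X is perfect: as G has no co-triangle, any two distinct vertices of
--     X ∖ v are adjacent, and v has no neighbour in X.  So every induced
--     subgraph F of X is a clique K, possibly plus an isolated vertex v,
--     which may reuse a colour of K; hence χ(F) = ω(F) = ∣ K ∣.

open import Defs
open import Data.Bool using (Bool; true; false)
import Data.Bool as Bool
open import Data.Bool.Properties using (¬-not; not-¬)
open import Data.Empty using (⊥-elim)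
open import Data.Fin using (Fin; zero; suc; punchOut; _≟_)
open import Data.Fin.Properties using (punchOut-injective; suc-injective; any?)
open import Data.Fin.Subset using (Subset; _∈_; _∉_; _⊆_; ∣_∣; inside; outside; _∩_; _∪_; ∁; ⁅_⁆; Nonempty)
open import Data.Fin.Subset.Properties
  using (_∈?_; nonempty?; p∩q⊆p; x∈p∩q⁺; x∈p∩q⁻; x∈∁p⇒x∉p; x∉p⇒x∈∁p; x≢y⇒x∉⁅y⁆; x∉⁅y⁆⇒x≢y;
         x∈⁅x⁆; x∈⁅y⁆⇒x≡y; p⊆p∪q; x∈p∪q⁺; x∈p∪q⁻; p⊂q⇒∣p∣<∣q∣)
open import Data.Nat using (ℕ; zero; suc; _≤_; _<_; z≤n; s≤s)
open import Data.Nat.Properties using (<⇒≱)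
open import Data.Product using (Σ; _×_; _,_; proj₁; proj₂; ∃-syntax)
import Data.Product as Product
open import Data.Sum using (inj₁; inj₂)
open import Data.Vec using ([]; _∷_; here; there; tabulate)
open import Data.Vec.Properties using (lookup∘tabulate; []=⇒lookup; lookup⇒[]=)
open import Relation.Nullary using (¬_; yes; no)
open import Relation.Nullary.Decidable using (¬?; _×-dec_)
open import Relation.Binary.PropositionalEquality using (_≡_; _≢_; refl; sym; trans; cong; ≢-sym)

InjectiveLabelling : ∀ {n} → Subset n → ℕ → Set
InjectiveLabelling {n} D m = Σ ((v : Fin n) → v ∈ D → Fin m) λ f →
  ∀ u w (u∈D : u ∈ D) (w∈D : w ∈ D) → f u u∈D ≡ f w w∈D → u ≡ w

-- Removing the label of the first member (punchOut)
-- turns a labelling of inside ∷ D by Fin (suc m) into one of D by Fin m.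
labelling⇒size≤ : ∀ {n m} (D : Subset n) → InjectiveLabelling D m → ∣ D ∣ ≤ m
labelling⇒size≤ [] _ = z≤n
labelling⇒size≤ (outside ∷ D) (f , inj) =
  labelling⇒size≤ D ((λ v p → f (suc v) (there p)) ,
                     λ u w pu pw e → suc-injective (inj _ _ _ _ e))
labelling⇒size≤ {m = zero} (inside ∷ D) (f , _) with f zero here
... | ()
labelling⇒size≤ {m = suc m} (inside ∷ D) (f , inj) = s≤s (labelling⇒size≤ D (f′ , inj′))
  where
  first≢rest : ∀ v p → f zero here ≢ f (suc v) (there p)
  first≢rest v p e with inj _ _ _ _ e
  ... | ()
  f′ : (v : Fin _) → v ∈ D → Fin m
  f′ v p = punchOut (first≢rest v p)
  inj′ : ∀ u w (pu : u ∈ D) (pw : w ∈ D) → f′ u pu ≡ f′ w pw → u ≡ w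
  inj′ u w pu pw e = suc-injective (inj _ _ _ _ (punchOut-injective (first≢rest u pu) (first≢rest w pw) e))

rank : ∀ {n} (D : Subset n) → InjectiveLabelling D ∣ D ∣
rank [] = (λ _ ()) , λ _ _ ()
rank (outside ∷ D) = f , inj
  where
  f : (v : Fin _) → v ∈ outside ∷ D → Fin ∣ D ∣
  f (suc v) (there p) = proj₁ (rank D) v p
  inj : ∀ u w pu pw → f u pu ≡ f w pw → u ≡ w
  inj (suc u) (suc w) (there pu) (there pw) e = cong suc (proj₂ (rank D) u w pu pw e)
rank (inside ∷ D) = f , inj
  where
  f : (v : Fin _) → v ∈ inside ∷ D → Fin (suc ∣ D ∣)
  f zero here = zero
  f (suc v) (there p) = suc (proj₁ (rank D) v p)
  inj : ∀ u w pu pw → f u pu ≡ f w pw → u ≡ w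
  inj zero zero here here _ = refl
  inj zero (suc w) here (there pw) ()
  inj (suc u) zero (there pu) here ()
  inj (suc u) (suc w) (there pu) (there pw) e =
    cong suc (proj₂ (rank D) u w pu pw (suc-injective e))

∈tabulate⁺ : ∀ {n} (f : Fin n → Bool) {w} → f w ≡ true → w ∈ tabulate f
∈tabulate⁺ f {w} fw = lookup⇒[]= w (tabulate f) (trans (lookup∘tabulate f w) fw)

∈tabulate⁻ : ∀ {n} (f : Fin n → Bool) {w} → w ∈ tabulate f → f w ≡ true
∈tabulate⁻ f {w} w∈ = trans (sym (lookup∘tabulate f w)) ([]=⇒lookup w∈)

_∖_ : ∀ {n} → Subset n → Fin n → Subset n
F ∖ v = F ∩ ∁ ⁅ v ⁆

∈∖⁺ : ∀ {n} {F : Subset n} {u v} → u ∈ F → u ≢ v → u ∈ F ∖ v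
∈∖⁺ u∈F u≢v = x∈p∩q⁺ (u∈F , x∉p⇒x∈∁p (x≢y⇒x∉⁅y⁆ u≢v))

∈∖⁻ : ∀ {n} {F : Subset n} {u v} → u ∈ F ∖ v → u ∈ F × u ≢ v
∈∖⁻ {F = F} u∈F∖v = Product.map₂ (λ u∈∁v → x∉⁅y⁆⇒x≢y (x∈∁p⇒x∉p u∈∁v)) (x∈p∩q⁻ F _ u∈F∖v)

positive⇒nonempty : ∀ {n} (p : Subset n) → 0 < ∣ p ∣ → Nonempty p
positive⇒nonempty (inside ∷ p) _ = zero , here
positive⇒nonempty (outside ∷ p) pos = Product.map suc there (positive⇒nonempty p pos)

module _ (G : Graph) where
  open Graph G using (n; adj; irrefl) renaming (sym to adj-sym)

  Complete : Subset n → Set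
  Complete F = ∀ u w → u ∈ F → w ∈ F → u ≢ w → adj u w ≡ true

  -- The vertices of a clique receive pairwise distinct colours, so the
  -- colouring restricted to the clique is an injective labelling: ω ≤ χ.
  clique≤colours : ∀ {F K m} → IsClique G F K → ProperColouring G F m → ∣ K ∣ ≤ m
  clique≤colours {K = K} (K⊆F , complete) (c , proper) = labelling⇒size≤ K ((λ v p → c v (K⊆F p)) , injective)
    where
    injective : ∀ u w (pu : u ∈ K) (pw : w ∈ K) → c u (K⊆F pu) ≡ c w (K⊆F pw) → u ≡ w
    injective u w pu pw e with u ≟ w
    ... | yes u≡w = u≡w
    ... | no u≢w = ⊥-elim (proper u w _ _ (complete u w pu pw u≢w) e)

  -- Adjacent vertices are distinct, so an injective labelling is proper.
  injective⇒proper : ∀ {F m} → InjectiveLabelling F m → ProperColouring G F m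
  injective⇒proper (f , inj) = f , proper
    where
    proper : ∀ u w pu pw → adj u w ≡ true → f u pu ≢ f w pw
    proper u w pu pw uw e with inj u w pu pw e
    ... | refl = not-¬ (irrefl u) uw

  χ≡ω-certificate : ∀ {F K} → IsClique G F K → ProperColouring G F ∣ K ∣ →
                    ∃[ k ] (ChromaticNumber G F k × CliqueNumber G F k)
  χ≡ω-certificate {K = K} clique colouring =
    ∣ K ∣ , (colouring , λ m c → clique≤colours clique c) ,
            (K , (clique , λ D D-clique → clique≤colours D-clique colouring) , refl)

  -- A complete F is its own maximum clique and is coloured by ranks.
  complete-χ≡ω : ∀ {F} → Complete F → ∃[ k ] (ChromaticNumber G F k × CliqueNumber G F k)
  complete-χ≡ω {F} complete = χ≡ω-certificate ((λ p → p) , complete) (injective⇒proper (rank F))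

  complete⇒perfect : ∀ {X} → Complete X → IsPerfect G X
  complete⇒perfect complete F F⊆X = complete-χ≡ω λ u w pu pw → complete u w (F⊆X pu) (F⊆X pw)

  extendByIsolated : ∀ {F v m} → (∀ w → w ∈ F → adj v w ≡ false) →
                     ProperColouring G (F ∖ v) m → Fin m → ProperColouring G F m
  extendByIsolated {F} {v} {m} isolated (c , proper) colourOfV = col , col-proper
    where
    col : (w : Fin n) → w ∈ F → Fin m
    col w w∈F with w ≟ v
    ... | yes _ = colourOfV
    ... | no w≢v = c w (∈∖⁺ w∈F w≢v)
    col-proper : ∀ u w (pu : u ∈ F) (pw : w ∈ F) → adj u w ≡ true → col u pu ≢ col w pw
    col-proper u w pu pw uw with u ≟ v | w ≟ v
    ... | yes refl | _ = λ _ → not-¬ (isolated w pw) uw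
    ... | no _ | yes refl = λ _ → not-¬ (isolated u pu) (trans (adj-sym v u) uw)
    ... | no _ | no _ = proper u w _ _ uw

  -- If X ∖ v is complete and v has no neighbour in X, then X is perfect:
  -- an induced subgraph F is complete if F ⊆ {v}; otherwise F ∖ v is a
  -- maximum clique of F and v reuses the colour of some vertex of F ∖ v.
  cliquePlusIsolated⇒perfect : ∀ {X} v → Complete (X ∖ v) → (∀ w → w ∈ X → adj v w ≡ false) → IsPerfect G X
  cliquePlusIsolated⇒perfect v complete isolated F F⊆X
    with any? (λ w → (w ∈? F) ×-dec ¬? (w ≟ v))
  ... | no onlyV = complete-χ≡ω λ u w pu pw u≢w → ⊥-elim (u≢w (trans (isV pu) (sym (isV pw))))
    where
    isV : ∀ {w} → w ∈ F → w ≡ v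
    isV {w} w∈F with w ≟ v
    ... | yes w≡v = w≡v
    ... | no w≢v = ⊥-elim (onlyV (w , w∈F , w≢v))
  ... | yes (w₀ , w₀∈F , w₀≢v) =
    χ≡ω-certificate (K⊆F , K-complete)
      (extendByIsolated (λ w w∈F → isolated w (F⊆X w∈F)) (injective⇒proper (rank K))
                        (proj₁ (rank K) w₀ (∈∖⁺ w₀∈F w₀≢v)))
    where
    K : Subset n
    K = F ∖ v
    K⊆F : K ⊆ F
    K⊆F p = proj₁ (∈∖⁻ p)
    K-complete : ∀ u w → u ∈ K → w ∈ K → u ≢ w → adj u w ≡ true
    K-complete u w pu pw = complete u w (∈∖⁺ (F⊆X (K⊆F pu)) (proj₂ (∈∖⁻ pu)))
                                        (∈∖⁺ (F⊆X (K⊆F pw)) (proj₂ (∈∖⁻ pw)))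

  extendClique : ∀ {H C v} → IsClique G H C → v ∈ H → v ∉ C → (∀ w → w ∈ C → adj v w ≡ true) →
                 Σ (Subset n) λ D → IsClique G H D × ∣ C ∣ < ∣ D ∣
  extendClique {H} {C} {v} (C⊆H , complete) v∈H v∉C dominates =
    C ∪ ⁅ v ⁆ , (D⊆H , D-complete) ,
    p⊂q⇒∣p∣<∣q∣ (p⊆p∪q ⁅ v ⁆ , v , x∈p∪q⁺ (inj₂ (x∈⁅x⁆ v)) , v∉C)
    where
    D⊆H : C ∪ ⁅ v ⁆ ⊆ H
    D⊆H p with x∈p∪q⁻ C _ p
    ... | inj₁ w∈C = C⊆H w∈C
    ... | inj₂ w∈⁅v⁆ rewrite x∈⁅y⁆⇒x≡y v w∈⁅v⁆ = v∈H
    D-complete : ∀ u w → u ∈ C ∪ ⁅ v ⁆ → w ∈ C ∪ ⁅ v ⁆ → u ≢ w → adj u w ≡ true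
    D-complete u w pu pw u≢w with x∈p∪q⁻ C _ pu | x∈p∪q⁻ C _ pw
    ... | inj₁ u∈C | inj₁ w∈C = complete u w u∈C w∈C u≢w
    ... | inj₁ u∈C | inj₂ w∈⁅v⁆ rewrite x∈⁅y⁆⇒x≡y v w∈⁅v⁆ = trans (adj-sym u v) (dominates u u∈C)
    ... | inj₂ u∈⁅v⁆ | inj₁ w∈C rewrite x∈⁅y⁆⇒x≡y v u∈⁅v⁆ = dominates w w∈C
    ... | inj₂ u∈⁅v⁆ | inj₂ w∈⁅v⁆ = ⊥-elim (u≢w (trans (x∈⁅y⁆⇒x≡y v u∈⁅v⁆) (sym (x∈⁅y⁆⇒x≡y v w∈⁅v⁆))))

  -- The non-neighbours of v within H; v itself belongs to it (irreflexivity).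
  nonNeighbours : Subset n → Fin n → Subset n
  nonNeighbours H v = H ∩ ∁ (tabulate (adj v))

  ∈nonNeighbours⁺ : ∀ {H v w} → w ∈ H → adj v w ≡ false → w ∈ nonNeighbours H v
  ∈nonNeighbours⁺ {v = v} w∈H vw = x∈p∩q⁺ (w∈H , x∉p⇒x∈∁p λ w∈N → not-¬ vw (∈tabulate⁻ (adj v) w∈N))

  ∈nonNeighbours⁻ : ∀ {H v w} → w ∈ nonNeighbours H v → w ∈ H × adj v w ≡ false
  ∈nonNeighbours⁻ {H} {v} p =
    Product.map₂ (λ w∉N → ¬-not λ vw → x∈∁p⇒x∉p w∉N (∈tabulate⁺ (adj v) vw)) (x∈p∩q⁻ H _ p)

  -- For v ∈ H, the non-neighbours of v in H meet every maximum clique C of H: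
  -- otherwise v ∉ C and v is adjacent to all of C, so C was not maximum.
  nonNeighbours-meet-maxCliques : ∀ {H v} → v ∈ H → ∀ C → IsMaxClique G H C →
                                   ∃[ w ] (w ∈ C × w ∈ nonNeighbours H v)
  nonNeighbours-meet-maxCliques {H} {v} v∈H C (C-clique@(C⊆H , _) , maximum)
    with any? (λ w → (w ∈? C) ×-dec (adj v w Bool.≟ false))
  ... | yes (w , w∈C , vw) = w , w∈C , ∈nonNeighbours⁺ (C⊆H w∈C) vw
  ... | no allAdjacent with extendClique C-clique v∈H v∉C dominates
    where
    v∉C : v ∉ C
    v∉C v∈C = allAdjacent (v , v∈C , irrefl v)
    dominates : ∀ w → w ∈ C → adj v w ≡ true
    dominates w w∈C = ¬-not λ vw → allAdjacent (w , w∈C , vw)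
  ... | D , D-clique , larger = ⊥-elim (<⇒≱ larger (maximum D D-clique))

  noCoTriangle⇒nonNeighboursComplete : ¬ HasCoTriangle G → ∀ H v → Complete (nonNeighbours H v ∖ v)
  noCoTriangle⇒nonNeighboursComplete noCoTriangle H v u w pu pw u≢w =
    ¬-not λ uw → noCoTriangle (v , u , w , ≢-sym u≢v , ≢-sym w≢v , u≢w , vu , vw , uw)
    where
    u≢v : u ≢ v
    u≢v = proj₂ (∈∖⁻ pu)
    w≢v : w ≢ v
    w≢v = proj₂ (∈∖⁻ pw)
    vu : adj v u ≡ false
    vu = proj₂ (∈nonNeighbours⁻ (proj₁ (∈∖⁻ pu)))
    vw : adj v w ≡ false
    vw = proj₂ (∈nonNeighbours⁻ (proj₁ (∈∖⁻ pw)))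

mainTheorem13 : (G : Graph) → ¬ HasCoTriangle G → PerfectlyDivisible G
mainTheorem13 G noCoTriangle H with nonempty? H
... | no empty = H , (λ p → p) , meets , complete⇒perfect G λ u _ u∈H _ _ → ⊥-elim (empty (u , u∈H))
  where
  meets : ∀ C → IsMaxClique G H C → 0 < ∣ C ∣ → ∃[ v ] (v ∈ C × v ∈ H)
  meets C ((C⊆H , _) , _) positive =
    ⊥-elim (empty (Product.map₂ C⊆H (positive⇒nonempty C positive)))
... | yes (v , v∈H) =
  nonNeighbours G H v , p∩q⊆p H _ ,
  (λ C maximum _ → nonNeighbours-meet-maxCliques G v∈H C maximum) ,
  cliquePlusIsolated⇒perfect G v (noCoTriangle⇒nonNeighboursComplete G noCoTriangle H v)
                                 (λ w p → proj₂ (∈nonNeighbours⁻ G p))
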